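{- Let $a,b$ be positive integers with $a+2<2b+1<2a-1$. Let $x_F$ be the Fibonacci word, the fixed point of $0\mapsto 01$, $1\mapsto 0$, let $\mathcal{L}_F$ be the set of nonempty finite factors of $x_F$, and let $S:\mathcal{L}_F\to\mathbb{N}$ be given by $S(w)=a|w|_0+b|w|_1$. Let $C$ be the increasing enumeration of $\mathbb{N}\setminus S(\mathcal{L}_F)$ and $\Delta C=(C(n+1)-C(n))_{n\ge1}$. Let $x_H$ be the fixed point starting with $a$ of the morphism $h$ on the two-letter alphabet $\{a,b\}$ given by $h(a)=aab$, $h(b)=ab$. Then $\Delta C=\delta(x_H)$, where $\delta$ is the morphism given by $\delta(a)=1^{b-2}\,2\,1^{a-b-2}\,2$ and $\delta(b)=1^{2b-a-2}\,2\,1^{a-b-2}\,2$.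
   Context: $\mathbb{N}=\{1,2,3,\dots\}$. $|w|_0$ and $|w|_1$ denote the numbers of occurrences of $0$ and $1$ in $w$; the map $S$ is exactly a homomorphism of the Fibonacci language into $\mathbb{N}$ (i.e. $S(vw)=S(v)+S(w)$) with $S(0)=a$, $S(1)=b$. Here $a,b$ are used both as integers and as abstract letters. $\delta(x_H)$ is the concatenation of the images of the letters of $x_H$, and $1^m$ denotes $m$ copies of $1$. -}

module Defs where

open import Data.Nat using (ℕ; zero; suc; _+_; _*_; _∸_; _<_; _≤_)
open import Data.List using (List; []; _∷_; _++_; map; concatMap; upTo; replicate)
open import Data.Product using (Σ; ∃; _×_; _,_)
open import Relation.Binary.PropositionalEquality using (_≡_)
open import Relation.Nullary using (¬_)

data Bit : Set where
  𝟎 𝟏 : Bit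

data AB : Set where
  A B : AB

nth : {X : Set} → X → List X → ℕ → X
nth d []       _       = d
nth d (x ∷ xs) zero    = x
nth d (x ∷ xs) (suc n) = nth d xs n

iter : {X : Set} → (X → List X) → ℕ → List X → List X
iter σ zero    w = w
iter σ (suc k) w = iter σ k (concatMap σ w)

φ : Bit → List Bit
φ 𝟎 = 𝟎 ∷ 𝟏 ∷ []
φ 𝟏 = 𝟎 ∷ []

-- The Fibonacci word x_F (0-indexed): its n-th letter is the n-th letter of
-- the prefix φ^(n+1)(0), which has length > n.
xF : ℕ → Bit
xF n = nth 𝟎 (iter φ (suc n) (𝟎 ∷ [])) n

slice : {X : Set} → (ℕ → X) → ℕ → ℕ → List X
slice x i n = map (λ j → x (i + j)) (upTo n)

InLF : List Bit → Set
InLF w = ¬ (w ≡ []) × ∃ λ i → w ≡ slice xF i (Data.List.length w)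

count0 : List Bit → ℕ
count0 []       = 0
count0 (𝟎 ∷ w) = suc (count0 w)
count0 (𝟏 ∷ w) = count0 w

count1 : List Bit → ℕ
count1 []       = 0
count1 (𝟎 ∷ w) = count1 w
count1 (𝟏 ∷ w) = suc (count1 w)

S : ℕ → ℕ → List Bit → ℕ
S a b w = a * count0 w + b * count1 w

InImageS : ℕ → ℕ → ℕ → Set
InImageS a b n = ∃ λ w → InLF w × S a b w ≡ n

-- n ∈ ℕ ∖ S(𝓛_F), with ℕ = {1,2,3,...}
InComplement : ℕ → ℕ → ℕ → Set
InComplement a b n = 1 ≤ n × ¬ InImageS a b n

-- C : ℕ → ℕ (0-indexed) is the increasing enumeration of ℕ ∖ S(𝓛_F):
-- strictly increasing and with image exactly ℕ ∖ S(𝓛_F)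
IsIncreasingEnumeration : ℕ → ℕ → (ℕ → ℕ) → Set
IsIncreasingEnumeration a b C =
  (∀ n → C n < C (suc n)) ×
  (∀ n → InComplement a b (C n)) ×
  (∀ m → InComplement a b m → ∃ λ n → C n ≡ m)

Δ : (ℕ → ℕ) → ℕ → ℕ
Δ C n = C (suc n) ∸ C n

h : AB → List AB
h A = A ∷ A ∷ B ∷ []
h B = A ∷ B ∷ []

hPrefix : ℕ → List AB
hPrefix k = iter h k (A ∷ [])

xH : ℕ → AB
xH n = nth A (hPrefix (suc n)) n

δ : ℕ → ℕ → AB → List ℕ
δ a b A = replicate (b ∸ 2) 1 ++ 2 ∷ replicate (a ∸ b ∸ 2) 1 ++ 2 ∷ []
δ a b B = replicate (2 * b ∸ a ∸ 2) 1 ++ 2 ∷ replicate (a ∸ b ∸ 2) 1 ++ 2 ∷ []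

-- δ(x_H) as an infinite word (0-indexed): δ(x_H) is the concatenation of
-- δ(x_H(0)) δ(x_H(1)) ...; since every δ-block is nonempty, its n-th letter
-- is the n-th letter of δ(x_H(0) ... x_H(n)).
δxH : ℕ → ℕ → ℕ → ℕ
δxH a b n = nth 0 (concatMap (δ a b) (map xH (upTo (suc n)))) n

module Submission where

-- Since h is conjugate to φ² (ab·h(w) = φ²(w)·ab), x_H is x_F with a letter a prepended,
-- so the factors of x_F are the factors of x_H at positions ≥ 1. As h(x_H) = x_H and
-- |h(w)| + |w|_b = 3|w|, desubstitution shows that the number B(n) of b's in the prefix of
-- length n is balanced: a factor of length n contains B(n) or B(n) + 1 letters b, and both
-- cases occur. Hence S(𝓛_F) = {W(n), W(n) − (a − b) : n ≥ 1}, W(n) the weight of the prefix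
-- of length n. The running sum C of δ(x_H), started at 1, climbs the block
-- δ(x_H(j)) = 1^u 2 1^v 2 from W(j) + 1 to W(j + 1) + 1 and skips exactly W(j + 1) − (a − b)
-- and W(j + 1); a sequence with steps 1 and 2 enumerates the complement of its skipped values.

open import Defs
open import Data.Nat using (ℕ; zero; suc; _+_; _*_; _∸_; _<_; _≤_; _≤′_; _≤?_; _<?_; z≤n; s≤s; ≤′-refl; ≤′-step)
open import Data.Nat.Properties
open import Data.List using (List; []; _∷_; _++_; map; concatMap; upTo; applyUpTo; replicate; length; take)
open import Data.List.Properties using (∷-injective; length-++; ++-assoc; ++-identityʳ; ++-cancelʳ; map-++; concatMap-++; map-upTo; take-all)
open import Data.Nat.ListAction using (sum)
open import Data.Nat.ListAction.Properties using (sum-++)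
open import Data.List.Relation.Unary.All using (All; []; _∷_)
open import Data.List.Relation.Unary.All.Properties using (++⁺; replicate⁺)
open import Data.Product using (∃; ∃₂; _×_; _,_; proj₁; proj₂)
open import Data.Sum using (_⊎_; inj₁; inj₂) renaming (map to ⊎-map)
open import Data.Empty using (⊥-elim)
open import Function using (_∘_)
open import Data.Nat.Tactic.RingSolver using (solve-∀)
open import Algebra.Properties.CommutativeSemigroup +-commutativeSemigroup using () renaming (interchange to +-interchange)
open import Relation.Binary.PropositionalEquality
open import Relation.Nullary using (¬_; yes; no)

private variable
  X Y : Set

mono-≤-by-step : (f : ℕ → ℕ) → (∀ n → f n ≤ f (suc n)) → ∀ {m n} → m ≤ n → f m ≤ f n
mono-≤-by-step f step m≤n = go (≤⇒≤′ m≤n)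
  where
  go : ∀ {m n} → m ≤′ n → f m ≤ f n
  go ≤′-refl = ≤-refl
  go (≤′-step m≤′n) = ≤-trans (go m≤′n) (step _)

m≤n≤1+m⇒n≡m⊎n≡1+m : ∀ {m n} → m ≤ n → n ≤ suc m → n ≡ m ⊎ n ≡ suc m
m≤n≤1+m⇒n≡m⊎n≡1+m {m} {n} m≤n n≤1+m with m≤n⇒m<n∨m≡n n≤1+m
... | inj₁ n<1+m = inj₁ (≤-antisym (≤-pred n<1+m) m≤n)
... | inj₂ n≡1+m = inj₂ n≡1+m

nth-++ˡ : (d : X) (u v : List X) {n : ℕ} → n < length u → nth d (u ++ v) n ≡ nth d u n
nth-++ˡ d (x ∷ u) v {zero}  _         = refl
nth-++ˡ d (x ∷ u) v {suc n} (s≤s n<u) = nth-++ˡ d u v n<u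

nth-++ʳ : (d : X) (u v : List X) (n : ℕ) → nth d (u ++ v) (length u + n) ≡ nth d v n
nth-++ʳ d []      v n = refl
nth-++ʳ d (x ∷ u) v n = nth-++ʳ d u v n

nth-map : (f : X → Y) (d : X) (w : List X) (n : ℕ) → f (nth d w n) ≡ nth (f d) (map f w) n
nth-map f d []      n       = refl
nth-map f d (x ∷ w) zero    = refl
nth-map f d (x ∷ w) (suc n) = nth-map f d w n

++-injective : (u u′ : List X) {v v′ : List X} → length u ≡ length u′ → u ++ v ≡ u′ ++ v′ → u ≡ u′ × v ≡ v′
++-injective []      []        _  eq = refl , eq
++-injective (x ∷ u) (x′ ∷ u′) ∣u∣≡ eq with ∷-injective eq
... | refl , eq′ with ++-injective u u′ (suc-injective ∣u∣≡) eq′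
... | refl , v≡ = refl , v≡

-- Windows and occurrences in infinite words

window : (ℕ → X) → ℕ → ℕ → List X
window f p zero    = []
window f p (suc n) = f p ∷ window f (suc p) n

prefix : (ℕ → X) → ℕ → List X
prefix f = window f 0

OccursAt : (ℕ → X) → ℕ → List X → Set
OccursAt f p w = window f p (length w) ≡ w

length-window : (f : ℕ → X) (p n : ℕ) → length (window f p n) ≡ n
length-window f p zero    = refl
length-window f p (suc n) = cong suc (length-window f (suc p) n)

window-occurs : (f : ℕ → X) (p n : ℕ) → OccursAt f p (window f p n)
window-occurs f p n = cong (window f p) (length-window f p n)

window-++ : (f : ℕ → X) (p m n : ℕ) → window f p (m + n) ≡ window f p m ++ window f (p + m) n
window-++ f p zero    n = cong (λ q → window f q n) (sym (+-identityʳ p))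
window-++ f p (suc m) n = cong (f p ∷_)
  (trans (window-++ f (suc p) m n) (cong (λ q → window f (suc p) m ++ window f q n) (sym (+-suc p m))))

window-snoc : (f : ℕ → X) (p n : ℕ) → window f p (suc n) ≡ window f p n ++ f (p + n) ∷ []
window-snoc f p n = trans (cong (window f p) (+-comm 1 n)) (window-++ f p n 1)

window-split : (f : ℕ → X) (p : ℕ) {m n : ℕ} → m ≤ n → window f p n ≡ window f p m ++ window f (p + m) (n ∸ m)
window-split f p {m} {n} m≤n = trans (cong (window f p) (sym (m+[n∸m]≡n m≤n))) (window-++ f p m (n ∸ m))

window-shift : (f : ℕ → X) (i p n : ℕ) → window (λ j → f (i + j)) p n ≡ window f (i + p) n
window-shift f i p zero    = refl
window-shift f i p (suc n) = cong (f (i + p) ∷_)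
  (trans (window-shift f i (suc p) n) (cong (λ q → window f q n) (+-suc i p)))

window-≗ : {f g : ℕ → X} → (∀ i → f i ≡ g i) → (p n : ℕ) → window f p n ≡ window g p n
window-≗ f≗g p zero    = refl
window-≗ f≗g p (suc n) = cong₂ _∷_ (f≗g p) (window-≗ f≗g (suc p) n)

map-window : (g : X → Y) (f : ℕ → X) (p n : ℕ) → map g (window f p n) ≡ window (g ∘ f) p n
map-window g f p zero    = refl
map-window g f p (suc n) = cong (g (f p) ∷_) (map-window g f (suc p) n)

applyUpTo≡prefix : (f : ℕ → X) (n : ℕ) → applyUpTo f n ≡ prefix f n
applyUpTo≡prefix f zero    = refl
applyUpTo≡prefix f (suc n) = cong (f 0 ∷_) (trans (applyUpTo≡prefix (f ∘ suc) n) (window-shift f 1 0 n))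

map-upTo≡prefix : (f : ℕ → X) (n : ℕ) → map f (upTo n) ≡ prefix f n
map-upTo≡prefix f n = trans (map-upTo f n) (applyUpTo≡prefix f n)

slice≡window : (f : ℕ → X) (i n : ℕ) → slice f i n ≡ window f i n
slice≡window f i n = begin
  map (λ j → f (i + j)) (upTo n)  ≡⟨ map-upTo≡prefix _ n ⟩
  window (λ j → f (i + j)) 0 n    ≡⟨ window-shift f i 0 n ⟩
  window f (i + 0) n              ≡⟨ cong (λ q → window f q n) (+-identityʳ i) ⟩
  window f i n                    ∎
  where open ≡-Reasoning

nth-window : (d : X) (f : ℕ → X) (p : ℕ) {n r : ℕ} → r < n → nth d (window f p n) r ≡ f (p + r)
nth-window d f p {suc n} {zero}  _         = cong f (sym (+-identityʳ p))
nth-window d f p {suc n} {suc r} (s≤s r<n) = trans (nth-window d f (suc p) r<n) (cong f (sym (+-suc p r)))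

occurs-by-nth : (d : X) (f : ℕ → X) (p : ℕ) (v : List X) →
  (∀ {r} → r < length v → f (p + r) ≡ nth d v r) → OccursAt f p v
occurs-by-nth d f p []      _     = refl
occurs-by-nth d f p (x ∷ v) agree = cong₂ _∷_
  (trans (cong f (sym (+-identityʳ p))) (agree (s≤s z≤n)))
  (occurs-by-nth d f (suc p) v (λ r<v → trans (cong f (sym (+-suc p _))) (agree (s≤s r<v))))

occurs-++ : (f : ℕ → X) (p : ℕ) (u v : List X) →
  OccursAt f p (u ++ v) → OccursAt f p u × OccursAt f (p + length u) v
occurs-++ f p u v occ = ++-injective _ u (length-window f p (length u)) (begin
  window f p (length u) ++ window f (p + length u) (length v) ≡⟨ window-++ f p (length u) (length v) ⟨
  window f p (length u + length v)                           ≡⟨ cong (window f p) (length-++ u) ⟨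
  window f p (length (u ++ v))                               ≡⟨ occ ⟩
  u ++ v                                                     ∎)
  where open ≡-Reasoning

occurs-∷-shorten : (f g : ℕ → X) {q p m n : ℕ} (c : X) → OccursAt f q (c ∷ window g p n) → m ≤ n →
  OccursAt f q (c ∷ window g p m)
occurs-∷-shorten f g {q} {p} {m} {n} c occ m≤n = proj₁ (occurs-++ f q (c ∷ window g p m) (window g (p + m) (n ∸ m))
  (subst (OccursAt f q) (cong (c ∷_) (window-split g p m≤n)) occ))

-- Iterated morphisms and their fixed points

iter-suc : (σ : X → List X) (k : ℕ) (w : List X) → iter σ (suc k) w ≡ concatMap σ (iter σ k w)
iter-suc σ zero    w = refl
iter-suc σ (suc k) w = iter-suc σ k (concatMap σ w)

iter-++ : (σ : X → List X) (k : ℕ) (u v : List X) → iter σ k (u ++ v) ≡ iter σ k u ++ iter σ k v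
iter-++ σ zero    u v = refl
iter-++ σ (suc k) u v = trans (cong (iter σ k) (concatMap-++ σ u v)) (iter-++ σ k (concatMap σ u) (concatMap σ v))

length-concatMap-≥ : (σ : X → List Y) → (∀ x → 1 ≤ length (σ x)) → (w : List X) → length w ≤ length (concatMap σ w)
length-concatMap-≥ σ σ-nonerasing []      = z≤n
length-concatMap-≥ σ σ-nonerasing (x ∷ w) = begin
  suc (length w)                         ≤⟨ +-mono-≤ (σ-nonerasing x) (length-concatMap-≥ σ σ-nonerasing w) ⟩
  length (σ x) + length (concatMap σ w)  ≡⟨ length-++ (σ x) ⟨
  length (concatMap σ (x ∷ w))           ∎
  where open ≤-Reasoning

module Concatenation (x : ℕ → X) (τ : X → List Y) (τ-nonerasing : ∀ y → 1 ≤ length (τ y)) where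

  offset : ℕ → ℕ
  offset j = length (concatMap τ (prefix x j))

  flatten : Y → ℕ → Y
  flatten d n = nth d (concatMap τ (prefix x (suc n))) n

  offset-suc : ∀ j → offset (suc j) ≡ offset j + length (τ (x j))
  offset-suc j = begin
    length (concatMap τ (prefix x (suc j)))                ≡⟨ cong (length ∘ concatMap τ) (window-snoc x 0 j) ⟩
    length (concatMap τ (prefix x j ++ x j ∷ []))          ≡⟨ cong length (concatMap-++ τ (prefix x j) (x j ∷ [])) ⟩
    length (concatMap τ (prefix x j) ++ τ (x j) ++ [])     ≡⟨ length-++ (concatMap τ (prefix x j)) ⟩
    offset j + length (τ (x j) ++ [])                      ≡⟨ cong (λ v → offset j + length v) (++-identityʳ (τ (x j))) ⟩
    offset j + length (τ (x j))                            ∎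
    where open ≡-Reasoning

  ≤offset : ∀ j → j ≤ offset j
  ≤offset j = subst (_≤ offset j) (length-window x 0 j) (length-concatMap-≥ τ τ-nonerasing (prefix x j))

  concatMap-prefix-split : ∀ j k →
    concatMap τ (prefix x (j + suc k)) ≡ concatMap τ (prefix x j) ++ τ (x j) ++ concatMap τ (window x (suc j) k)
  concatMap-prefix-split j k =
    trans (cong (concatMap τ) (window-++ x 0 j (suc k))) (concatMap-++ τ (prefix x j) (window x j (suc k)))

  flatten-block : ∀ d j {r} → r < length (τ (x j)) → flatten d (offset j + r) ≡ nth d (τ (x j)) r
  flatten-block d j {r} r<∣τx∣ = begin
    nth d (concatMap τ (prefix x (suc n))) n                               ≡⟨ cong (λ m → nth d (concatMap τ (prefix x m)) n) 1+n≡ ⟩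
    nth d (concatMap τ (prefix x (j + suc (n ∸ j)))) (offset j + r)        ≡⟨ cong (λ v → nth d v n) (concatMap-prefix-split j (n ∸ j)) ⟩
    nth d (concatMap τ (prefix x j) ++ τ (x j) ++ rest) (offset j + r)     ≡⟨ nth-++ʳ d (concatMap τ (prefix x j)) _ r ⟩
    nth d (τ (x j) ++ rest) r                                              ≡⟨ nth-++ˡ d (τ (x j)) rest r<∣τx∣ ⟩
    nth d (τ (x j)) r                                                      ∎
    where
    open ≡-Reasoning
    n : ℕ
    n = offset j + r
    rest : List Y
    rest = concatMap τ (window x (suc j) (n ∸ j))
    1+n≡ : suc n ≡ j + suc (n ∸ j)
    1+n≡ = trans (cong suc (sym (m+[n∸m]≡n (≤-trans (≤offset j) (m≤m+n (offset j) r))))) (sym (+-suc j (n ∸ j)))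

  block-decomposition : ∀ n → ∃₂ λ j r → r < length (τ (x j)) × offset j + r ≡ n
  block-decomposition zero = 0 , 0 , τ-nonerasing (x 0) , refl
  block-decomposition (suc n) with block-decomposition n
  ... | j , r , r<∣τx∣ , offset+r≡n with suc r <? length (τ (x j))
  ...   | yes 1+r<∣τx∣ = j , suc r , 1+r<∣τx∣ , trans (+-suc (offset j) r) (cong suc offset+r≡n)
  ...   | no  1+r≮∣τx∣ = suc j , 0 , τ-nonerasing (x (suc j)) , (begin
    offset (suc j) + 0             ≡⟨ +-identityʳ (offset (suc j)) ⟩
    offset (suc j)                 ≡⟨ offset-suc j ⟩
    offset j + length (τ (x j))    ≡⟨ cong (offset j +_) (≤-antisym r<∣τx∣ (≮⇒≥ 1+r≮∣τx∣)) ⟨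
    offset j + suc r               ≡⟨ +-suc (offset j) r ⟩
    suc (offset j + r)             ≡⟨ cong suc offset+r≡n ⟩
    suc n                          ∎)
    where open ≡-Reasoning

module Prolongable (σ : X → List X) (c : X) {d : X} {t : List X} (σ-c : σ c ≡ c ∷ d ∷ t)
                   (σ-nonerasing : ∀ x → 1 ≤ length (σ x)) where

  iterate : ℕ → List X
  iterate k = iter σ k (c ∷ [])

  -- For (h, A) and (φ, 𝟎) this is definitionally xH and xF.
  fixedPoint : ℕ → X
  fixedPoint n = nth c (iterate (suc n)) n

  open Concatenation fixedPoint σ σ-nonerasing public

  iterate-suc : ∀ k → iterate (suc k) ≡ iterate k ++ iter σ k (d ∷ t)
  iterate-suc k = begin
    iter σ k (σ c ++ [])            ≡⟨ cong (λ w → iter σ k (w ++ [])) σ-c ⟩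
    iter σ k (c ∷ d ∷ t ++ [])      ≡⟨ iter-++ σ k (c ∷ []) (d ∷ t ++ []) ⟩
    iterate k ++ iter σ k (d ∷ t ++ [])  ≡⟨ cong (λ w → iterate k ++ iter σ k (d ∷ w)) (++-identityʳ t) ⟩
    iterate k ++ iter σ k (d ∷ t)   ∎
    where open ≡-Reasoning

  length-iter-≥ : ∀ k w → length w ≤ length (iter σ k w)
  length-iter-≥ zero    w = ≤-refl
  length-iter-≥ (suc k) w = ≤-trans (length-concatMap-≥ σ σ-nonerasing w) (length-iter-≥ k (concatMap σ w))

  length-iterate : ∀ k → k < length (iterate k)
  length-iterate zero    = s≤s z≤n
  length-iterate (suc k) = begin-strict
    suc k                                             <⟨ m<m+n (suc k) (s≤s z≤n) ⟩
    suc k + 1                                         ≤⟨ +-mono-≤ (length-iterate k) (≤-trans (s≤s z≤n) (length-iter-≥ k (d ∷ t))) ⟩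
    length (iterate k) + length (iter σ k (d ∷ t))    ≡⟨ length-++ (iterate k) ⟨
    length (iterate k ++ iter σ k (d ∷ t))            ≡⟨ cong length (iterate-suc k) ⟨
    length (iterate (suc k))                          ∎
    where open ≤-Reasoning

  iterate-prefix : ∀ {k k′} → k ≤′ k′ → ∃ λ w → iterate k′ ≡ iterate k ++ w
  iterate-prefix {k} ≤′-refl = [] , sym (++-identityʳ (iterate k))
  iterate-prefix {k} (≤′-step {n} k≤′n) with iterate-prefix k≤′n
  ... | w , eq = w ++ iter σ n (d ∷ t) , (begin
    iterate (suc n)                        ≡⟨ iterate-suc n ⟩
    iterate n ++ iter σ n (d ∷ t)          ≡⟨ cong (_++ iter σ n (d ∷ t)) eq ⟩
    (iterate k ++ w) ++ iter σ n (d ∷ t)   ≡⟨ ++-assoc (iterate k) w _ ⟩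
    iterate k ++ w ++ iter σ n (d ∷ t)     ∎)
    where open ≡-Reasoning

  nth-iterate-stable : ∀ {k k′ n} → k ≤ k′ → n < length (iterate k) → nth c (iterate k′) n ≡ nth c (iterate k) n
  nth-iterate-stable {k} k≤k′ n<∣k∣ with iterate-prefix (≤⇒≤′ k≤k′)
  ... | w , eq = trans (cong (λ v → nth c v _) eq) (nth-++ˡ c (iterate k) w n<∣k∣)

  fixedPoint-nth : ∀ k {n} → n < length (iterate k) → fixedPoint n ≡ nth c (iterate k) n
  fixedPoint-nth k {n} n<∣k∣ with ≤-total k (suc n)
  ... | inj₁ k≤1+n = nth-iterate-stable k≤1+n n<∣k∣
  ... | inj₂ 1+n≤k = sym (nth-iterate-stable 1+n≤k (<-trans (n<1+n n) (length-iterate (suc n))))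

  iterate-occurs : ∀ k → OccursAt fixedPoint 0 (iterate k)
  iterate-occurs k = occurs-by-nth c fixedPoint 0 (iterate k) (fixedPoint-nth k)

  σ-prefix-occurs : ∀ j → OccursAt fixedPoint 0 (concatMap σ (prefix fixedPoint j))
  σ-prefix-occurs j = proj₁ (occurs-++ fixedPoint 0 (concatMap σ (prefix fixedPoint j)) (concatMap σ rest)
    (subst (OccursAt fixedPoint 0) iterate-suc-split (iterate-occurs (suc j))))
    where
    rest : List X
    rest = window fixedPoint j (length (iterate j) ∸ j)
    iterate-suc-split : iterate (suc j) ≡ concatMap σ (prefix fixedPoint j) ++ concatMap σ rest
    iterate-suc-split = begin
      iterate (suc j)                                 ≡⟨ iter-suc σ j (c ∷ []) ⟩
      concatMap σ (iterate j)                         ≡⟨ cong (concatMap σ)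
                                                           (trans (sym (iterate-occurs j)) (window-split fixedPoint 0 (<⇒≤ (length-iterate j)))) ⟩
      concatMap σ (prefix fixedPoint j ++ rest)       ≡⟨ concatMap-++ σ (prefix fixedPoint j) rest ⟩
      concatMap σ (prefix fixedPoint j) ++ concatMap σ rest ∎
      where open ≡-Reasoning

  σ-occurs : ∀ q w → OccursAt fixedPoint q w → OccursAt fixedPoint (offset q) (concatMap σ w)
  σ-occurs q w occ = proj₂ (occurs-++ fixedPoint 0 (concatMap σ (prefix fixedPoint q)) (concatMap σ w)
    (subst (OccursAt fixedPoint 0) prefix-split (σ-prefix-occurs (q + length w))))
    where
    prefix-split : concatMap σ (prefix fixedPoint (q + length w)) ≡ concatMap σ (prefix fixedPoint q) ++ concatMap σ w
    prefix-split = begin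
      concatMap σ (prefix fixedPoint (q + length w))                    ≡⟨ cong (concatMap σ) (window-++ fixedPoint 0 q (length w)) ⟩
      concatMap σ (prefix fixedPoint q ++ window fixedPoint q (length w)) ≡⟨ cong (λ v → concatMap σ (prefix fixedPoint q ++ v)) occ ⟩
      concatMap σ (prefix fixedPoint q ++ w)                            ≡⟨ concatMap-++ σ (prefix fixedPoint q) w ⟩
      concatMap σ (prefix fixedPoint q) ++ concatMap σ w                ∎
      where open ≡-Reasoning

  fixedPoint-σ-block : ∀ j {r} → r < length (σ (fixedPoint j)) →
    fixedPoint (offset j + r) ≡ nth c (σ (fixedPoint j)) r
  fixedPoint-σ-block j {r} r<∣σx∣ = begin
    fixedPoint (offset j + r)                         ≡⟨ nth-window c fixedPoint (offset j) r<∣σxj[]∣ ⟨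
    nth c (window fixedPoint (offset j) (length σxj[])) r ≡⟨ cong (λ v → nth c v r) occ ⟩
    nth c σxj[] r                                          ≡⟨ nth-++ˡ c (σ (fixedPoint j)) [] r<∣σx∣ ⟩
    nth c (σ (fixedPoint j)) r                             ∎
    where
    open ≡-Reasoning
    σxj[] : List X
    σxj[] = σ (fixedPoint j) ++ []
    occ : OccursAt fixedPoint (offset j) σxj[]
    occ = σ-occurs j (fixedPoint j ∷ []) (window-occurs fixedPoint j 1)
    r<∣σxj[]∣ : r < length σxj[]
    r<∣σxj[]∣ = subst (λ v → r < length v) (sym (++-identityʳ (σ (fixedPoint j)))) r<∣σx∣

-- Balance of x_H

h-nonerasing : ∀ x → 1 ≤ length (h x)
h-nonerasing A = s≤s z≤n
h-nonerasing B = s≤s z≤n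

module Fix-h = Prolongable h A refl h-nonerasing

L : ℕ → ℕ
L = Fix-h.offset

#B : AB → ℕ
#B A = 0
#B B = 1

countB : List AB → ℕ
countB w = sum (map #B w)

prefixB : ℕ → ℕ
prefixB n = countB (prefix xH n)

countB-++ : ∀ u v → countB (u ++ v) ≡ countB u + countB v
countB-++ u v = trans (cong sum (map-++ #B u v)) (sum-++ (map #B u) (map #B v))

countB-concatMap-h : ∀ w → countB (concatMap h w) ≡ length w
countB-concatMap-h []      = refl
countB-concatMap-h (x ∷ w) = trans (countB-++ (h x) (concatMap h w)) (cong₂ _+_ (countB-h x) (countB-concatMap-h w))
  where
  countB-h : ∀ x → countB (h x) ≡ 1
  countB-h A = refl
  countB-h B = refl

length-concatMap-h : ∀ w → length (concatMap h w) + countB w ≡ 3 * length w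
length-concatMap-h []      = refl
length-concatMap-h (x ∷ w) = begin
  length (h x ++ concatMap h w) + (#B x + countB w)         ≡⟨ cong (_+ (#B x + countB w)) (length-++ (h x)) ⟩
  (length (h x) + length (concatMap h w)) + (#B x + countB w) ≡⟨ +-interchange (length (h x)) _ (#B x) _ ⟩
  (length (h x) + #B x) + (length (concatMap h w) + countB w) ≡⟨ cong₂ _+_ (length-h-+-#B x) (length-concatMap-h w) ⟩
  3 + 3 * length w                                          ≡⟨ *-suc 3 (length w) ⟨
  3 * length (x ∷ w)                                        ∎
  where
  open ≡-Reasoning
  length-h-+-#B : ∀ x → length (h x) + #B x ≡ 3
  length-h-+-#B A = refl
  length-h-+-#B B = refl

prefixB-suc : ∀ n → prefixB (suc n) ≡ prefixB n + #B (xH n)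
prefixB-suc n = begin
  countB (prefix xH (suc n))           ≡⟨ cong countB (window-snoc xH 0 n) ⟩
  countB (prefix xH n ++ xH n ∷ [])    ≡⟨ countB-++ (prefix xH n) (xH n ∷ []) ⟩
  prefixB n + (#B (xH n) + 0)          ≡⟨ cong (prefixB n +_) (+-identityʳ (#B (xH n))) ⟩
  prefixB n + #B (xH n)                ∎
  where open ≡-Reasoning

#B≤1 : ∀ x → #B x ≤ 1
#B≤1 A = z≤n
#B≤1 B = ≤-refl

prefixB-suc-≤ : ∀ n → prefixB (suc n) ≤ suc (prefixB n)
prefixB-suc-≤ n = begin
  prefixB (suc n)        ≡⟨ prefixB-suc n ⟩
  prefixB n + #B (xH n)  ≤⟨ +-monoʳ-≤ (prefixB n) (#B≤1 (xH n)) ⟩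
  prefixB n + 1          ≡⟨ +-comm (prefixB n) 1 ⟩
  suc (prefixB n)        ∎
  where open ≤-Reasoning

prefixB-mono : ∀ {m n} → m ≤ n → prefixB m ≤ prefixB n
prefixB-mono = mono-≤-by-step prefixB (λ n → subst (prefixB n ≤_) (sym (prefixB-suc n)) (m≤m+n (prefixB n) _))

prefixB-2+ : ∀ k → prefixB (2 + k) ≤ k
prefixB-2+ zero    = z≤n
prefixB-2+ (suc k) = ≤-trans (prefixB-suc-≤ (2 + k)) (s≤s (prefixB-2+ k))

prefixB-L : ∀ j → prefixB (L j) ≡ j
prefixB-L j = begin
  countB (prefix xH (L j))          ≡⟨ cong countB (Fix-h.σ-prefix-occurs j) ⟩
  countB (concatMap h (prefix xH j)) ≡⟨ countB-concatMap-h (prefix xH j) ⟩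
  length (prefix xH j)              ≡⟨ length-window xH 0 j ⟩
  j                                 ∎
  where open ≡-Reasoning

L-+-prefixB : ∀ j → L j + prefixB j ≡ 3 * j
L-+-prefixB j = trans (length-concatMap-h (prefix xH j)) (cong (3 *_) (length-window xH 0 j))

h-ends-with-B : ∀ x → ∃ λ u → h x ≡ u ++ B ∷ [] × 1 ≤ length u
h-ends-with-B A = A ∷ A ∷ [] , refl , s≤s z≤n
h-ends-with-B B = A ∷ [] , refl , s≤s z≤n

L-suc-ends-with-B : ∀ j → ∃ λ p → L (suc j) ≡ suc p × xH p ≡ B
L-suc-ends-with-B j with h-ends-with-B (xH j)
... | u , hx≡ , _ = L j + length u , L-suc≡ , xH-p≡B
  where
  open ≡-Reasoning
  L-suc≡ : L (suc j) ≡ suc (L j + length u)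
  L-suc≡ = begin
    L (suc j)                          ≡⟨ Fix-h.offset-suc j ⟩
    L j + length (h (xH j))            ≡⟨ cong (λ v → L j + length v) hx≡ ⟩
    L j + length (u ++ B ∷ [])         ≡⟨ cong (L j +_) (trans (length-++ u) (+-comm (length u) 1)) ⟩
    L j + suc (length u)               ≡⟨ +-suc (L j) (length u) ⟩
    suc (L j + length u)               ∎
  ∣u∣<∣hx∣ : length u < length (h (xH j))
  ∣u∣<∣hx∣ = subst (λ v → length u < length v) (sym hx≡)
    (subst (length u <_) (sym (length-++ u)) (m<m+n (length u) (s≤s z≤n)))
  xH-p≡B : xH (L j + length u) ≡ B
  xH-p≡B = begin
    xH (L j + length u)                ≡⟨ Fix-h.fixedPoint-σ-block j ∣u∣<∣hx∣ ⟩
    nth A (h (xH j)) (length u)        ≡⟨ cong₂ (nth A) hx≡ (sym (+-identityʳ (length u))) ⟩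
    nth A (u ++ B ∷ []) (length u + 0) ≡⟨ nth-++ʳ A u (B ∷ []) 0 ⟩
    B                                  ∎

L≤⇒≤prefixB : ∀ {k m} → L k ≤ m → k ≤ prefixB m
L≤⇒≤prefixB {k} {m} Lk≤m = subst (_≤ prefixB m) (prefixB-L k) (prefixB-mono Lk≤m)

<L⇒prefixB< : ∀ {k m} → m < L k → prefixB m < k
<L⇒prefixB< {suc j} {m} m<L with L-suc-ends-with-B j
... | p , L≡1+p , xHp≡B = s≤s (begin
  prefixB m  ≤⟨ prefixB-mono (≤-pred (subst (m <_) L≡1+p m<L)) ⟩
  prefixB p  ≡⟨ suc-injective prefixB-1+p ⟩
  j          ∎)
  where
  open ≤-Reasoning
  prefixB-1+p : suc (prefixB p) ≡ suc j
  prefixB-1+p = begin-equality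
    suc (prefixB p)        ≡⟨ +-comm 1 (prefixB p) ⟩
    prefixB p + #B B       ≡⟨ cong (λ x → prefixB p + #B x) xHp≡B ⟨
    prefixB p + #B (xH p)  ≡⟨ prefixB-suc p ⟨
    prefixB (suc p)        ≡⟨ cong prefixB L≡1+p ⟨
    prefixB (L (suc j))    ≡⟨ prefixB-L (suc j) ⟩
    suc j                  ∎

L-prefixB≤ : ∀ m → L (prefixB m) ≤ m
L-prefixB≤ m = ≮⇒≥ (λ m<L → <-irrefl refl (<L⇒prefixB< m<L))

<L-suc-prefixB : ∀ m → m < L (suc (prefixB m))
<L-suc-prefixB m = ≰⇒> (λ L≤m → 1+n≰n (L≤⇒≤prefixB L≤m))

L-+-prefixB-+ : ∀ i j → L (i + j) + prefixB (i + j) ≡ (L i + L j) + (prefixB i + prefixB j)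
L-+-prefixB-+ i j = begin
  L (i + j) + prefixB (i + j)               ≡⟨ L-+-prefixB (i + j) ⟩
  3 * (i + j)                               ≡⟨ *-distribˡ-+ 3 i j ⟩
  3 * i + 3 * j                             ≡⟨ cong₂ _+_ (L-+-prefixB i) (L-+-prefixB j) ⟨
  (L i + prefixB i) + (L j + prefixB j)     ≡⟨ +-interchange (L i) (prefixB i) (L j) (prefixB j) ⟩
  (L i + L j) + (prefixB i + prefixB j)     ∎
  where open ≡-Reasoning

L-subadditive : ∀ i j → prefixB i + prefixB j ≤ prefixB (i + j) → L (i + j) ≤ L i + L j
L-subadditive i j super = +-cancelʳ-≤ (prefixB (i + j)) _ _ (begin
  L (i + j) + prefixB (i + j)            ≡⟨ L-+-prefixB-+ i j ⟩
  (L i + L j) + (prefixB i + prefixB j)  ≤⟨ +-monoʳ-≤ (L i + L j) super ⟩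
  (L i + L j) + prefixB (i + j)          ∎)
  where open ≤-Reasoning

L-superadditive : ∀ i j → prefixB (i + j) ≤ suc (prefixB i + prefixB j) → L i + L j ≤ suc (L (i + j))
L-superadditive i j sub = +-cancelʳ-≤ (prefixB i + prefixB j) _ _ (begin
  (L i + L j) + (prefixB i + prefixB j)  ≡⟨ L-+-prefixB-+ i j ⟨
  L (i + j) + prefixB (i + j)            ≤⟨ +-monoʳ-≤ (L (i + j)) sub ⟩
  L (i + j) + suc (prefixB i + prefixB j) ≡⟨ +-suc (L (i + j)) _ ⟩
  suc (L (i + j)) + (prefixB i + prefixB j) ∎)
  where open ≤-Reasoning

Balanced : ℕ → ℕ → Set
Balanced p q = prefixB p + prefixB q ≤ prefixB (p + q) × prefixB (p + q) ≤ suc (prefixB p + prefixB q)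

balanced-comm : ∀ p q → Balanced p q → Balanced q p
balanced-comm p q bal rewrite +-comm q p | +-comm (prefixB q) (prefixB p) = bal

balanced-0 : ∀ q → Balanced 0 q
balanced-0 q = ≤-refl , n≤1+n (prefixB q)

balanced-1 : ∀ q → Balanced 1 q
balanced-1 q = prefixB-mono (n≤1+n q) , prefixB-suc-≤ q

balanced-≤ : ∀ s p q → p + q ≤ s → Balanced p q
balanced-≤ s 0 q _ = balanced-0 q
balanced-≤ s 1 q _ = balanced-1 q
balanced-≤ s (suc (suc p′)) 0 _ = balanced-comm 0 (2 + p′) (balanced-0 (2 + p′))
balanced-≤ s (suc (suc p′)) 1 _ = balanced-comm 1 (2 + p′) (balanced-1 (2 + p′))
-- Desubstitution: p and q lie in the h-blocks of positions j₁ = prefixB p and j₂ = prefixB q,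
-- and L j + prefixB j = 3j carries the bounds for (j₁, j₂) and (j₁ + 1, j₂ + 1) over to (p, q).
balanced-≤ (suc s) p@(suc (suc p′)) q@(suc (suc q′)) p+q≤1+s = lower , upper
  where
  j₁ j₂ : ℕ
  j₁ = prefixB p
  j₂ = prefixB q
  fuel : suc j₁ + suc j₂ ≤ s
  fuel = ≤-trans (+-mono-≤ (s≤s (prefixB-2+ p′)) (s≤s (prefixB-2+ q′)))
                 (≤-trans (+-monoʳ-≤ (suc p′) (n≤1+n (suc q′))) (≤-pred p+q≤1+s))
  lower : j₁ + j₂ ≤ prefixB (p + q)
  lower = L≤⇒≤prefixB (≤-trans
    (L-subadditive j₁ j₂ (proj₁ (balanced-≤ s j₁ j₂ (≤-trans (+-mono-≤ (n≤1+n j₁) (n≤1+n j₂)) fuel))))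
    (+-mono-≤ (L-prefixB≤ p) (L-prefixB≤ q)))
  p+q<L : p + q < L (suc j₁ + suc j₂)
  p+q<L = subst (_≤ L (suc j₁ + suc j₂)) (+-suc p q) (≤-pred (≤-trans
    (+-mono-≤ (<L-suc-prefixB p) (<L-suc-prefixB q))
    (L-superadditive (suc j₁) (suc j₂) (proj₂ (balanced-≤ s (suc j₁) (suc j₂) fuel)))))
  upper : prefixB (p + q) ≤ suc (j₁ + j₂)
  upper = subst (prefixB (p + q) ≤_) (+-suc j₁ j₂) (≤-pred (<L⇒prefixB< p+q<L))

balanced : ∀ p q → Balanced p q
balanced p q = balanced-≤ (p + q) p q ≤-refl

countB-window : ∀ p n → countB (window xH p n) ≡ prefixB n ⊎ countB (window xH p n) ≡ suc (prefixB n)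
countB-window p n = m≤n≤1+m⇒n≡m⊎n≡1+m
  (+-cancelˡ-≤ (prefixB p) _ _ (subst (prefixB p + prefixB n ≤_) prefixB-+ (proj₁ (balanced p n))))
  (+-cancelˡ-≤ (prefixB p) _ _ (subst₂ _≤_ prefixB-+ (sym (+-suc (prefixB p) (prefixB n))) (proj₂ (balanced p n))))
  where
  prefixB-+ : prefixB (p + n) ≡ prefixB p + countB (window xH p n)
  prefixB-+ = trans (cong countB (window-++ xH 0 p n)) (countB-++ (prefix xH p) (window xH p n))

-- Recurrence in x_H

-- x_H = h(x_H) = aab·h(x_H[1..]), so x_H[1..] = ab·h(x_H[1..]).
xH-tail-image : ∀ m → OccursAt xH 1 (A ∷ B ∷ concatMap h (window xH 1 m))
xH-tail-image m = cong (λ v → A ∷ B ∷ v) (Fix-h.σ-occurs 1 (window xH 1 m) (window-occurs xH 1 m))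

<length-tail-image : ∀ m → m < 2 + length (concatMap h (window xH 1 m))
<length-tail-image m = s≤s (≤-trans m≤∣image∣ (n≤1+n _))
  where
  m≤∣image∣ : m ≤ length (concatMap h (window xH 1 m))
  m≤∣image∣ = subst (_≤ length (concatMap h (window xH 1 m))) (length-window xH 1 m)
                    (length-concatMap-≥ h h-nonerasing (window xH 1 m))

prefix-reoccurs : ∀ m → ∃ λ q → 1 ≤ q × OccursAt xH q (A ∷ window xH 1 m)
prefix-reoccurs zero    = 1 , ≤-refl , refl
prefix-reoccurs (suc m) with prefix-reoccurs m
... | q , 1≤q , occ = L q , ≤-trans 1≤q (Fix-h.≤offset q) , occurs-∷-shorten xH xH {m = suc m} A image-occurs (<length-tail-image m)
  where
  image-occurs : OccursAt xH (L q) (A ∷ window xH 1 (2 + length (concatMap h (window xH 1 m))))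
  image-occurs = subst (λ v → OccursAt xH (L q) (A ∷ v)) (sym (xH-tail-image m)) (Fix-h.σ-occurs q _ occ)

-- If b·w occurs at q + 1, then h(x_H(q))·ab·h(w) occurs, and h(x_H(q)) ends with b.
B-variant-occurs : ∀ m → ∃ λ q → 1 ≤ q × OccursAt xH q (B ∷ window xH 1 m)
B-variant-occurs zero    = 2 , s≤s z≤n , refl
B-variant-occurs (suc m) with B-variant-occurs m
... | suc q , _ , occ with h-ends-with-B (xH q)
...   | u , hx≡ , 1≤∣u∣ = L q + length u , ≤-trans 1≤∣u∣ (m≤n+m _ (L q)) ,
        occurs-∷-shorten xH xH {m = suc m} B (proj₂ (occurs-++ xH (L q) u _ image-occurs)) (<length-tail-image m)
  where
  w : List AB
  w = window xH 1 m
  image-occurs : OccursAt xH (L q) (u ++ B ∷ window xH 1 (2 + length (concatMap h w)))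
  image-occurs = subst (OccursAt xH (L q)) (begin
    concatMap h (xH q ∷ B ∷ w)                          ≡⟨ cong (_++ concatMap h (B ∷ w)) hx≡ ⟩
    (u ++ B ∷ []) ++ A ∷ B ∷ concatMap h w              ≡⟨ ++-assoc u (B ∷ []) _ ⟩
    u ++ B ∷ A ∷ B ∷ concatMap h w                      ≡⟨ cong (λ v → u ++ B ∷ v) (xH-tail-image m) ⟨
    u ++ B ∷ window xH 1 (2 + length (concatMap h w))   ∎)
    (Fix-h.σ-occurs q _ (cong (xH q ∷_) occ))
    where open ≡-Reasoning

-- x_F as a tail of x_H

ab : Bit → AB
ab 𝟎 = A
ab 𝟏 = B

φ-nonerasing : ∀ x → 1 ≤ length (φ x)
φ-nonerasing 𝟎 = s≤s z≤n
φ-nonerasing 𝟏 = s≤s z≤n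

module Fix-φ = Prolongable φ 𝟎 refl φ-nonerasing

φ²-conjugate-h : ∀ w → A ∷ B ∷ concatMap h (map ab w) ≡ map ab (concatMap φ (concatMap φ w)) ++ A ∷ B ∷ []
φ²-conjugate-h []      = refl
φ²-conjugate-h (𝟎 ∷ w) = cong (λ v → A ∷ B ∷ A ∷ v) (φ²-conjugate-h w)
φ²-conjugate-h (𝟏 ∷ w) = cong (λ v → A ∷ B ∷ v) (φ²-conjugate-h w)

-- k * 2 rather than 2 * k, so that suc k * 2 reduces to 2 + k * 2.
φ²-iterate : ∀ k → A ∷ map ab (Fix-φ.iterate (k * 2)) ≡ hPrefix k ++ A ∷ []
φ²-iterate zero    = refl
φ²-iterate (suc k) = ++-cancelʳ (A ∷ B ∷ []) _ _ (begin
  (A ∷ map ab (Fix-φ.iterate (2 + k * 2))) ++ A ∷ B ∷ []               ≡⟨ cong (λ v → A ∷ map ab v ++ A ∷ B ∷ []) φ²-step ⟩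
  A ∷ map ab (concatMap φ (concatMap φ (Fix-φ.iterate (k * 2)))) ++ A ∷ B ∷ [] ≡⟨ cong (A ∷_) (φ²-conjugate-h (Fix-φ.iterate (k * 2))) ⟨
  concatMap h (A ∷ map ab (Fix-φ.iterate (k * 2)))                     ≡⟨ cong (concatMap h) (φ²-iterate k) ⟩
  concatMap h (hPrefix k ++ A ∷ [])                                ≡⟨ concatMap-++ h (hPrefix k) (A ∷ []) ⟩
  concatMap h (hPrefix k) ++ A ∷ A ∷ B ∷ []                        ≡⟨ cong (_++ A ∷ A ∷ B ∷ []) (iter-suc h k (A ∷ [])) ⟨
  hPrefix (suc k) ++ A ∷ A ∷ B ∷ []                                ≡⟨ ++-assoc (hPrefix (suc k)) (A ∷ []) (A ∷ B ∷ []) ⟨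
  (hPrefix (suc k) ++ A ∷ []) ++ A ∷ B ∷ []                        ∎)
  where
  open ≡-Reasoning
  φ²-step : Fix-φ.iterate (2 + k * 2) ≡ concatMap φ (concatMap φ (Fix-φ.iterate (k * 2)))
  φ²-step = trans (iter-suc φ (suc (k * 2)) (𝟎 ∷ [])) (cong (concatMap φ) (iter-suc φ (k * 2) (𝟎 ∷ [])))

ab-xF : ∀ n → ab (xF n) ≡ xH (suc n)
ab-xF n = begin
  ab (xF n)                                        ≡⟨ cong ab (Fix-φ.fixedPoint-nth (suc n * 2) n<∣φ-iterate∣) ⟩
  ab (nth 𝟎 (Fix-φ.iterate (suc n * 2)) n)             ≡⟨ nth-map ab 𝟎 (Fix-φ.iterate (suc n * 2)) n ⟩
  nth A (A ∷ map ab (Fix-φ.iterate (suc n * 2))) (suc n) ≡⟨ cong (λ v → nth A v (suc n)) (φ²-iterate (suc n)) ⟩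
  nth A (hPrefix (suc n) ++ A ∷ []) (suc n)        ≡⟨ nth-++ˡ A (hPrefix (suc n)) (A ∷ []) (Fix-h.length-iterate (suc n)) ⟩
  nth A (hPrefix (suc n)) (suc n)                  ≡⟨ Fix-h.fixedPoint-nth (suc n) (Fix-h.length-iterate (suc n)) ⟨
  xH (suc n)                                       ∎
  where
  open ≡-Reasoning
  n<∣φ-iterate∣ : n < length (Fix-φ.iterate (suc n * 2))
  n<∣φ-iterate∣ = ≤-trans (m≤m*n (suc n) 2) (<⇒≤ (Fix-φ.length-iterate (suc n * 2)))

map-ab-slice : ∀ i n → map ab (slice xF i n) ≡ window xH (suc i) n
map-ab-slice i n = begin
  map ab (slice xF i n)        ≡⟨ cong (map ab) (slice≡window xF i n) ⟩
  map ab (window xF i n)       ≡⟨ map-window ab xF i n ⟩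
  window (ab ∘ xF) i n         ≡⟨ window-≗ ab-xF i n ⟩
  window (xH ∘ suc) i n        ≡⟨ window-shift xH 1 i n ⟩
  window xH (suc i) n          ∎
  where open ≡-Reasoning

-- Weights of factors

nonempty⇒1≤length : (w : List X) → ¬ (w ≡ []) → 1 ≤ length w
nonempty⇒1≤length []      w≢[] = ⊥-elim (w≢[] refl)
nonempty⇒1≤length (_ ∷ _) _    = s≤s z≤n

factor-of-xH-tail : ∀ i (v : List AB) → 1 ≤ length v → OccursAt xH (suc i) v → ∃ λ w → InLF w × map ab w ≡ v
factor-of-xH-tail i v@(_ ∷ _) _ occ = slice xF i (length v) , (nonempty , i , sym (cong (slice xF i) length-slice)) ,
  trans (map-ab-slice i (length v)) occ
  where
  nonempty : ¬ (slice xF i (length v) ≡ [])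
  nonempty ()
  length-slice : length (slice xF i (length v)) ≡ length v
  length-slice = trans (cong length (slice≡window xF i (length v))) (length-window xF i (length v))

module Weights (a b : ℕ) (b≤a : b ≤ a) where

  val : AB → ℕ
  val A = a
  val B = b

  weight : List AB → ℕ
  weight w = sum (map val w)

  weight-++ : ∀ u v → weight (u ++ v) ≡ weight u + weight v
  weight-++ u v = trans (cong sum (map-++ val u v)) (sum-++ (map val u) (map val v))

  S≡weight : ∀ w → S a b w ≡ weight (map ab w)
  S≡weight []      = cong₂ _+_ (*-zeroʳ a) (*-zeroʳ b)
  S≡weight (𝟎 ∷ w) = begin
    a * suc (count0 w) + b * count1 w     ≡⟨ cong (_+ b * count1 w) (*-suc a (count0 w)) ⟩
    (a + a * count0 w) + b * count1 w     ≡⟨ +-assoc a _ _ ⟩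
    a + S a b w                           ≡⟨ cong (a +_) (S≡weight w) ⟩
    a + weight (map ab w)                 ∎
    where open ≡-Reasoning
  S≡weight (𝟏 ∷ w) = begin
    a * count0 w + b * suc (count1 w)     ≡⟨ cong (a * count0 w +_) (*-suc b (count1 w)) ⟩
    a * count0 w + (b + b * count1 w)     ≡⟨ +-comm (a * count0 w) _ ⟩
    (b + b * count1 w) + a * count0 w     ≡⟨ +-assoc b _ _ ⟩
    b + (b * count1 w + a * count0 w)     ≡⟨ cong (b +_) (+-comm (b * count1 w) _) ⟩
    b + S a b w                           ≡⟨ cong (b +_) (S≡weight w) ⟩
    b + weight (map ab w)                 ∎
    where open ≡-Reasoning

  weight-+-countB : ∀ w → weight w + (a ∸ b) * countB w ≡ a * length w
  weight-+-countB []      = trans (*-zeroʳ (a ∸ b)) (sym (*-zeroʳ a))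
  weight-+-countB (A ∷ w) = begin
    (a + weight w) + (a ∸ b) * countB w   ≡⟨ +-assoc a _ _ ⟩
    a + (weight w + (a ∸ b) * countB w)   ≡⟨ cong (a +_) (weight-+-countB w) ⟩
    a + a * length w                      ≡⟨ *-suc a (length w) ⟨
    a * length (A ∷ w)                    ∎
    where open ≡-Reasoning
  weight-+-countB (B ∷ w) = begin
    (b + weight w) + (a ∸ b) * suc (countB w)            ≡⟨ cong ((b + weight w) +_) (*-suc (a ∸ b) (countB w)) ⟩
    (b + weight w) + ((a ∸ b) + (a ∸ b) * countB w)      ≡⟨ +-interchange b _ _ _ ⟩
    (b + (a ∸ b)) + (weight w + (a ∸ b) * countB w)      ≡⟨ cong₂ _+_ (m+[n∸m]≡n b≤a) (weight-+-countB w) ⟩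
    a + a * length w                                     ≡⟨ *-suc a (length w) ⟨
    a * length (B ∷ w)                                   ∎
    where open ≡-Reasoning

  weight-≡ : ∀ u v → length u ≡ length v → countB u ≡ countB v → weight u ≡ weight v
  weight-≡ u v ∣u∣≡∣v∣ cu≡cv = +-cancelʳ-≡ ((a ∸ b) * countB v) _ _ (begin
    weight u + (a ∸ b) * countB v         ≡⟨ cong (λ k → weight u + (a ∸ b) * k) cu≡cv ⟨
    weight u + (a ∸ b) * countB u         ≡⟨ weight-+-countB u ⟩
    a * length u                          ≡⟨ cong (a *_) ∣u∣≡∣v∣ ⟩
    a * length v                          ≡⟨ weight-+-countB v ⟨
    weight v + (a ∸ b) * countB v         ∎)
    where open ≡-Reasoning

  weight-+-gap : ∀ u v → length u ≡ length v → countB u ≡ suc (countB v) → weight u + (a ∸ b) ≡ weight v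
  weight-+-gap u v ∣u∣≡∣v∣ cu≡1+cv = +-cancelʳ-≡ ((a ∸ b) * countB v) _ _ (begin
    weight u + (a ∸ b) + (a ∸ b) * countB v    ≡⟨ +-assoc (weight u) _ _ ⟩
    weight u + ((a ∸ b) + (a ∸ b) * countB v)  ≡⟨ cong (weight u +_) (*-suc (a ∸ b) (countB v)) ⟨
    weight u + (a ∸ b) * suc (countB v)        ≡⟨ cong (λ k → weight u + (a ∸ b) * k) cu≡1+cv ⟨
    weight u + (a ∸ b) * countB u              ≡⟨ weight-+-countB u ⟩
    a * length u                               ≡⟨ cong (a *_) ∣u∣≡∣v∣ ⟩
    a * length v                               ≡⟨ weight-+-countB v ⟨
    weight v + (a ∸ b) * countB v              ∎)
    where open ≡-Reasoning

  W : ℕ → ℕ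
  W n = weight (prefix xH n)

  -- The form of an element of S(𝓛_F): a factor of length n weighs W n, or a − b less
  -- when it has one more letter b than the prefix of length n.
  FactorWeight : ℕ → Set
  FactorWeight m = ∃ λ n → 1 ≤ n × (m ≡ W n ⊎ m + (a ∸ b) ≡ W n)

  InImageS⇒FactorWeight : ∀ {m} → InImageS a b m → FactorWeight m
  InImageS⇒FactorWeight {m} (w , (w≢[] , i , w≡slice) , Sw≡m) =
    length w , nonempty⇒1≤length w w≢[] , by-countB (countB-window (suc i) (length w))
    where
    v : List AB
    v = window xH (suc i) (length w)
    S≡weight-v : S a b w ≡ weight v
    S≡weight-v = trans (S≡weight w) (cong weight (trans (cong (map ab) w≡slice) (map-ab-slice i (length w))))
    ∣v∣≡∣prefix∣ : length v ≡ length (prefix xH (length w))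
    ∣v∣≡∣prefix∣ = trans (length-window xH (suc i) (length w)) (sym (length-window xH 0 (length w)))
    by-countB : countB v ≡ prefixB (length w) ⊎ countB v ≡ suc (prefixB (length w)) →
      m ≡ W (length w) ⊎ m + (a ∸ b) ≡ W (length w)
    by-countB (inj₁ same) = inj₁ (trans (sym Sw≡m) (trans S≡weight-v (weight-≡ v (prefix xH (length w)) ∣v∣≡∣prefix∣ same)))
    by-countB (inj₂ more) = inj₂ (trans (cong (_+ (a ∸ b)) (trans (sym Sw≡m) S≡weight-v)) (weight-+-gap v (prefix xH (length w)) ∣v∣≡∣prefix∣ more))

  FactorWeight⇒InImageS : ∀ {m} → FactorWeight m → InImageS a b m
  FactorWeight⇒InImageS (suc n , _ , inj₁ m≡W) with prefix-reoccurs n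
  ... | suc i , _ , occ with factor-of-xH-tail i _ (s≤s z≤n) occ
  ...   | w , w∈LF , w↦prefix = w , w∈LF , trans (S≡weight w) (trans (cong weight w↦prefix) (sym m≡W))
  FactorWeight⇒InImageS {m} (suc n , _ , inj₂ m+gap≡W) with B-variant-occurs n
  ... | suc i , _ , occ with factor-of-xH-tail i _ (s≤s z≤n) occ
  ...   | w , w∈LF , w↦variant = w , w∈LF , +-cancelʳ-≡ (a ∸ b) _ _ (begin
    S a b w + (a ∸ b)                   ≡⟨ cong (λ k → k + (a ∸ b)) (trans (S≡weight w) (cong weight w↦variant)) ⟩
    weight (B ∷ window xH 1 n) + (a ∸ b) ≡⟨ weight-+-gap (B ∷ window xH 1 n) (prefix xH (suc n)) refl refl ⟩
    W (suc n)                           ≡⟨ m+gap≡W ⟨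
    m + (a ∸ b)                         ∎)
    where open ≡-Reasoning

-- Sequences with steps 1 and 2, and the blocks of δ(x_H)

module Cumulative (d : ℕ → ℕ) (d∈12 : ∀ n → d n ≡ 1 ⊎ d n ≡ 2) where

  cumulative : ℕ → ℕ
  cumulative zero    = 1
  cumulative (suc n) = cumulative n + d n

  IsGap : ℕ → Set
  IsGap m = ∃ λ i → d i ≡ 2 × suc (cumulative i) ≡ m

  Δ-cumulative : ∀ n → Δ cumulative n ≡ d n
  Δ-cumulative n = m+n∸m≡n (cumulative n) (d n)

  cumulative-<-suc : ∀ n → cumulative n < cumulative (suc n)
  cumulative-<-suc n = m<m+n (cumulative n) 1≤dn
    where
    1≤dn : 1 ≤ d n
    1≤dn with d∈12 n
    ... | inj₁ dn≡1 = subst (1 ≤_) (sym dn≡1) ≤-refl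
    ... | inj₂ dn≡2 = subst (1 ≤_) (sym dn≡2) (s≤s z≤n)

  cumulative-mono : ∀ {m n} → m ≤ n → cumulative m ≤ cumulative n
  cumulative-mono = mono-≤-by-step cumulative (<⇒≤ ∘ cumulative-<-suc)

  cumulative-covers : ∀ k → (∃ λ n → cumulative n ≡ suc k) ⊎ IsGap (suc k)
  cumulative-covers zero = inj₁ (0 , refl)
  cumulative-covers (suc k) with cumulative-covers k
  ... | inj₂ (i , di≡2 , gap≡) = inj₁ (suc i , (begin
    cumulative i + d i      ≡⟨ cong (cumulative i +_) di≡2 ⟩
    cumulative i + 2        ≡⟨ +-comm (cumulative i) 2 ⟩
    suc (suc (cumulative i)) ≡⟨ cong suc gap≡ ⟩
    suc (suc k)             ∎))
    where open ≡-Reasoning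
  ... | inj₁ (n , Cn≡) with d∈12 n
  ...   | inj₁ dn≡1 = inj₁ (suc n , trans (cong (cumulative n +_) dn≡1) (trans (+-comm (cumulative n) 1) (cong suc Cn≡)))
  ...   | inj₂ dn≡2 = inj₂ (n , dn≡2 , cong suc Cn≡)

  gap-missed : ∀ n {m} → IsGap m → cumulative n ≢ m
  gap-missed n (i , di≡2 , refl) Cn≡ with n ≤? i
  ... | yes n≤i = 1+n≰n (subst (_≤ cumulative i) Cn≡ (cumulative-mono n≤i))
  ... | no  n≰i = 1+n≰n (begin
    suc (suc (cumulative i))  ≡⟨ +-comm 2 (cumulative i) ⟩
    cumulative i + 2          ≡⟨ cong (cumulative i +_) di≡2 ⟨
    cumulative (suc i)        ≤⟨ cumulative-mono (≰⇒> n≰i) ⟩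
    cumulative n              ≡⟨ Cn≡ ⟩
    suc (cumulative i)        ∎)
    where open ≤-Reasoning

  enumerates-complement : (T : ℕ → Set) → (∀ {m} → IsGap m → T m) → (∀ {m} → T m → IsGap m) →
    (∀ n → cumulative n < cumulative (suc n)) ×
    (∀ n → 1 ≤ cumulative n × ¬ T (cumulative n)) ×
    (∀ m → 1 ≤ m × ¬ T m → ∃ λ n → cumulative n ≡ m)
  enumerates-complement T gap⇒T T⇒gap =
    cumulative-<-suc , (λ n → cumulative-mono {0} {n} z≤n , λ T-Cn → gap-missed n (T⇒gap T-Cn) refl) , hit
    where
    hit : ∀ m → 1 ≤ m × ¬ T m → ∃ λ n → cumulative n ≡ m
    hit (suc k) (_ , ¬T) with cumulative-covers k
    ... | inj₁ hit-k = hit-k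
    ... | inj₂ gap   = ⊥-elim (¬T (gap⇒T gap))

block : ℕ → ℕ → List ℕ
block u v = replicate u 1 ++ 2 ∷ replicate v 1 ++ 2 ∷ []

nth-All : {P : X → Set} (d : X) {l : List X} → All P l → ∀ {r} → r < length l → P (nth d l r)
nth-All d (p ∷ _)  {zero}  _         = p
nth-All d (_ ∷ ps) {suc r} (s≤s r<l) = nth-All d ps r<l

nth-block-∈12 : ∀ u v {r} → r < length (block u v) → nth 0 (block u v) r ≡ 1 ⊎ nth 0 (block u v) r ≡ 2
nth-block-∈12 u v = nth-All {P = λ k → k ≡ 1 ⊎ k ≡ 2} 0 (++⁺ (replicate⁺ u (inj₁ refl)) (inj₂ refl ∷ ++⁺ (replicate⁺ v (inj₁ refl)) (inj₂ refl ∷ [])))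

nth-block-≡2 : ∀ u v r → nth 0 (block u v) r ≡ 2 → r ≡ u ⊎ r ≡ u + suc v
nth-block-≡2 zero    v zero    _   = inj₁ refl
nth-block-≡2 zero    v (suc r) eq  = inj₂ (cong suc (second-2 v r eq))
  where
  second-2 : ∀ v r → nth 0 (replicate v 1 ++ 2 ∷ []) r ≡ 2 → r ≡ v
  second-2 zero    zero    _  = refl
  second-2 (suc v) (suc r) eq = cong suc (second-2 v r eq)
nth-block-≡2 (suc u) v (suc r) eq with nth-block-≡2 u v r eq
... | inj₁ r≡u      = inj₁ (cong suc r≡u)
... | inj₂ r≡u+1+v  = inj₂ (cong suc r≡u+1+v)

nth-block-first-2 : ∀ u v → nth 0 (block u v) u ≡ 2
nth-block-first-2 zero    v = refl
nth-block-first-2 (suc u) v = nth-block-first-2 u v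

nth-block-second-2 : ∀ u v → nth 0 (block u v) (u + suc v) ≡ 2
nth-block-second-2 zero    zero    = refl
nth-block-second-2 zero    (suc v) = nth-block-second-2 zero v
nth-block-second-2 (suc u) v       = nth-block-second-2 u v

sum-take-ones : ∀ v w → sum (take v (replicate v 1 ++ w)) ≡ v
sum-take-ones zero    w = refl
sum-take-ones (suc v) w = cong suc (sum-take-ones v w)

sum-ones : ∀ v w → sum (replicate v 1 ++ w) ≡ v + sum w
sum-ones zero    w = refl
sum-ones (suc v) w = cong suc (sum-ones v w)

sum-take-block-first : ∀ u v → sum (take u (block u v)) ≡ u
sum-take-block-first u v = sum-take-ones u _

sum-take-block-second : ∀ u v → sum (take (u + suc v) (block u v)) ≡ u + 2 + v
sum-take-block-second zero    v = cong (2 +_) (sum-take-ones v _)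
sum-take-block-second (suc u) v = cong suc (sum-take-block-second u v)

sum-block : ∀ u v → sum (block u v) ≡ u + 2 + (v + 2)
sum-block zero    v = cong (2 +_) (sum-ones v (2 ∷ []))
sum-block (suc u) v = cong suc (sum-block u v)

length-block : ∀ u v → u + suc v < length (block u v)
length-block zero    zero    = s≤s (s≤s z≤n)
length-block zero    (suc v) = s≤s (length-block zero v)
length-block (suc u) v       = s≤s (length-block u v)

sum-take-suc : ∀ l {r} → r < length l → sum (take (suc r) l) ≡ sum (take r l) + nth 0 l r
sum-take-suc (k ∷ l) {zero}  _         = +-comm k 0
sum-take-suc (k ∷ l) {suc r} (s≤s r<l) = trans (cong (k +_) (sum-take-suc l r<l)) (sym (+-assoc k _ _))

module Enumeration (a b : ℕ) (b+2≤a : b + 2 ≤ a) (a+2≤2b : a + 2 ≤ 2 * b) where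

  b≤a : b ≤ a
  b≤a = ≤-trans (m≤m+n b 2) b+2≤a

  open Weights a b b≤a public

  lead : AB → ℕ
  lead A = b ∸ 2
  lead B = 2 * b ∸ a ∸ 2

  middle : ℕ
  middle = a ∸ b ∸ 2

  δ≡block : ∀ x → δ a b x ≡ block (lead x) middle
  δ≡block A = refl
  δ≡block B = refl

  middle+2≡gap : middle + 2 ≡ a ∸ b
  middle+2≡gap = m∸n+n≡m (m+n≤o⇒m≤o∸n 2 (subst (_≤ a) (+-comm b 2) b+2≤a))

  lead+2+gap≡val : ∀ x → lead x + 2 + (a ∸ b) ≡ val x
  lead+2+gap≡val A = trans (cong (_+ (a ∸ b)) (m∸n+n≡m 2≤b)) (m+[n∸m]≡n b≤a)
    where
    2b≡b+b : 2 * b ≡ b + b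
    2b≡b+b = cong (b +_) (+-identityʳ b)
    2≤b : 2 ≤ b
    2≤b = +-cancelˡ-≤ b 2 b (≤-trans b+2≤a (≤-trans (m≤m+n a 2) (subst (a + 2 ≤_) 2b≡b+b a+2≤2b)))
  lead+2+gap≡val B = +-cancelʳ-≡ b _ _ (begin
    (2 * b ∸ a ∸ 2) + 2 + (a ∸ b) + b   ≡⟨ cong (λ k → k + (a ∸ b) + b) (m∸n+n≡m (m+n≤o⇒m≤o∸n 2 (subst (_≤ 2 * b) (+-comm a 2) a+2≤2b))) ⟩
    (2 * b ∸ a) + (a ∸ b) + b           ≡⟨ +-assoc (2 * b ∸ a) (a ∸ b) b ⟩
    (2 * b ∸ a) + ((a ∸ b) + b)         ≡⟨ cong ((2 * b ∸ a) +_) (m∸n+n≡m b≤a) ⟩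
    (2 * b ∸ a) + a                     ≡⟨ m∸n+n≡m (≤-trans (m≤m+n a 2) a+2≤2b) ⟩
    2 * b                               ≡⟨ cong (b +_) (+-identityʳ b) ⟩
    b + b                               ∎)
    where open ≡-Reasoning

  sum-δ : ∀ x → sum (block (lead x) middle) ≡ val x
  sum-δ x = trans (sum-block (lead x) middle) (trans (cong (lead x + 2 +_) middle+2≡gap) (lead+2+gap≡val x))

  δ-nonerasing : ∀ x → 1 ≤ length (δ a b x)
  δ-nonerasing x = subst (λ l → 1 ≤ length l) (sym (δ≡block x)) (≤-trans (s≤s z≤n) (length-block (lead x) middle))

  open Concatenation xH (δ a b) δ-nonerasing

  blockOf : ℕ → List ℕ
  blockOf j = block (lead (xH j)) middle

  δxH-block : ∀ j {r} → r < length (blockOf j) → δxH a b (offset j + r) ≡ nth 0 (blockOf j) r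
  δxH-block j {r} r<∣block∣ = begin
    δxH a b (offset j + r)        ≡⟨ cong (λ w → nth 0 (concatMap (δ a b) w) (offset j + r)) (map-upTo≡prefix xH (suc (offset j + r))) ⟩
    flatten 0 (offset j + r)      ≡⟨ flatten-block 0 j (subst (λ l → r < length l) (sym (δ≡block (xH j))) r<∣block∣) ⟩
    nth 0 (δ a b (xH j)) r        ≡⟨ cong (λ l → nth 0 l r) (δ≡block (xH j)) ⟩
    nth 0 (blockOf j) r           ∎
    where open ≡-Reasoning

  δxH-decomposition : ∀ n → ∃₂ λ j r → r < length (blockOf j) × offset j + r ≡ n
  δxH-decomposition n with block-decomposition n
  ... | j , r , r<∣δ∣ , eq = j , r , subst (λ l → r < length l) (δ≡block (xH j)) r<∣δ∣ , eq

  δxH∈12 : ∀ n → δxH a b n ≡ 1 ⊎ δxH a b n ≡ 2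
  δxH∈12 n with δxH-decomposition n
  ... | j , r , r<∣block∣ , refl =
    ⊎-map (trans (δxH-block j r<∣block∣)) (trans (δxH-block j r<∣block∣)) (nth-block-∈12 (lead (xH j)) middle r<∣block∣)

  open Cumulative (δxH a b) δxH∈12 public

  W-suc : ∀ j → W (suc j) ≡ W j + val (xH j)
  W-suc j = begin
    weight (prefix xH (suc j))           ≡⟨ cong weight (window-snoc xH 0 j) ⟩
    weight (prefix xH j ++ xH j ∷ [])    ≡⟨ weight-++ (prefix xH j) (xH j ∷ []) ⟩
    W j + (val (xH j) + 0)               ≡⟨ cong (W j +_) (+-identityʳ (val (xH j))) ⟩
    W j + val (xH j)                     ∎
    where open ≡-Reasoning

  cumulative-block : ∀ j r → r ≤ length (blockOf j) →
    cumulative (offset j + r) ≡ cumulative (offset j) + sum (take r (blockOf j))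
  cumulative-block j zero    _ = trans (cong cumulative (+-identityʳ (offset j))) (sym (+-identityʳ _))
  cumulative-block j (suc r) r<∣block∣ = begin
    cumulative (offset j + suc r)                                          ≡⟨ cong cumulative (+-suc (offset j) r) ⟩
    cumulative (offset j + r) + δxH a b (offset j + r)                     ≡⟨ cong₂ _+_ (cumulative-block j r (<⇒≤ r<∣block∣)) (δxH-block j r<∣block∣) ⟩
    cumulative (offset j) + sum (take r (blockOf j)) + nth 0 (blockOf j) r ≡⟨ +-assoc (cumulative (offset j)) _ _ ⟩
    cumulative (offset j) + (sum (take r (blockOf j)) + nth 0 (blockOf j) r) ≡⟨ cong (cumulative (offset j) +_) (sum-take-suc (blockOf j) r<∣block∣) ⟨
    cumulative (offset j) + sum (take (suc r) (blockOf j))                 ∎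
    where open ≡-Reasoning

  cumulative-offset : ∀ j → cumulative (offset j) ≡ suc (W j)
  cumulative-offset zero    = refl
  cumulative-offset (suc j) = begin
    cumulative (offset (suc j))                                ≡⟨ cong cumulative (trans (offset-suc j) (cong (λ l → offset j + length l) (δ≡block (xH j)))) ⟩
    cumulative (offset j + length (blockOf j))                 ≡⟨ cumulative-block j (length (blockOf j)) ≤-refl ⟩
    cumulative (offset j) + sum (take (length (blockOf j)) (blockOf j)) ≡⟨ cong₂ _+_ (cumulative-offset j) (cong sum (take-all _ (blockOf j) ≤-refl)) ⟩
    suc (W j) + sum (blockOf j)                                ≡⟨ cong (λ k → suc (W j + k)) (sum-δ (xH j)) ⟩
    suc (W j + val (xH j))                                     ≡⟨ cong suc (W-suc j) ⟨
    suc (W (suc j))                                            ∎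
    where open ≡-Reasoning

  first-gap : ∀ j → suc (cumulative (offset j + lead (xH j))) + (a ∸ b) ≡ W (suc j)
  first-gap j = begin
    suc (cumulative (offset j + u)) + (a ∸ b)   ≡⟨ cong (λ k → suc k + (a ∸ b)) (cumulative-block j u u≤∣block∣) ⟩
    suc (cumulative (offset j) + sum (take u (blockOf j))) + (a ∸ b) ≡⟨ cong₂ (λ k l → suc (k + l) + (a ∸ b)) (cumulative-offset j) (sum-take-block-first u middle) ⟩
    suc (suc (W j) + u) + (a ∸ b)               ≡⟨ rearrange (W j) u (a ∸ b) ⟩
    W j + (u + 2 + (a ∸ b))                     ≡⟨ cong (W j +_) (lead+2+gap≡val (xH j)) ⟩
    W j + val (xH j)                            ≡⟨ W-suc j ⟨
    W (suc j)                                   ∎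
    where
    open ≡-Reasoning
    u : ℕ
    u = lead (xH j)
    u≤∣block∣ : u ≤ length (blockOf j)
    u≤∣block∣ = ≤-trans (m≤m+n u (suc middle)) (<⇒≤ (length-block u middle))
    rearrange : ∀ w u g → suc (suc w + u) + g ≡ w + (u + 2 + g)
    rearrange = solve-∀

  second-gap : ∀ j → suc (cumulative (offset j + (lead (xH j) + suc middle))) ≡ W (suc j)
  second-gap j = begin
    suc (cumulative (offset j + (u + suc middle)))  ≡⟨ cong suc (cumulative-block j (u + suc middle) (<⇒≤ (length-block u middle))) ⟩
    suc (cumulative (offset j) + sum (take (u + suc middle) (blockOf j))) ≡⟨ cong₂ (λ k l → suc (k + l)) (cumulative-offset j) (sum-take-block-second u middle) ⟩
    suc (suc (W j) + (u + 2 + middle))              ≡⟨ rearrange (W j) u middle ⟩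
    W j + (u + 2 + (middle + 2))                    ≡⟨ cong (W j +_) (sum-block u middle) ⟨
    W j + sum (blockOf j)                           ≡⟨ cong (W j +_) (sum-δ (xH j)) ⟩
    W j + val (xH j)                                ≡⟨ W-suc j ⟨
    W (suc j)                                       ∎
    where
    open ≡-Reasoning
    u : ℕ
    u = lead (xH j)
    rearrange : ∀ w u m → suc (suc w + (u + 2 + m)) ≡ w + (u + 2 + (m + 2))
    rearrange = solve-∀

  gap⇒FactorWeight : ∀ {m} → IsGap m → FactorWeight m
  gap⇒FactorWeight (i , δi≡2 , refl) with δxH-decomposition i
  ... | j , r , r<∣block∣ , refl with nth-block-≡2 (lead (xH j)) middle r (trans (sym (δxH-block j r<∣block∣)) δi≡2)
  ...   | inj₁ refl = suc j , s≤s z≤n , inj₂ (first-gap j)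
  ...   | inj₂ refl = suc j , s≤s z≤n , inj₁ (second-gap j)

  FactorWeight⇒gap : ∀ {m} → FactorWeight m → IsGap m
  FactorWeight⇒gap (suc j , _ , inj₁ m≡W) =
    offset j + (lead (xH j) + suc middle) ,
    trans (δxH-block j (length-block _ middle)) (nth-block-second-2 (lead (xH j)) middle) ,
    trans (second-gap j) (sym m≡W)
  FactorWeight⇒gap (suc j , _ , inj₂ m+gap≡W) =
    offset j + lead (xH j) ,
    trans (δxH-block j (<-trans (m<m+n _ (s≤s z≤n)) (length-block _ middle))) (nth-block-first-2 (lead (xH j)) middle) ,
    +-cancelʳ-≡ (a ∸ b) _ _ (trans (first-gap j) (sym m+gap≡W))

a+2<2b+1⇒a+2≤2b : ∀ {a b} → a + 2 < 2 * b + 1 → a + 2 ≤ 2 * b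
a+2<2b+1⇒a+2≤2b {a} {b} a+2<2b+1 = ≤-pred (subst (suc (a + 2) ≤_) (+-comm (2 * b) 1) a+2<2b+1)

2b+1<2a∸1⇒b+2≤a : ∀ {a b} → 2 * b + 1 < 2 * a ∸ 1 → b + 2 ≤ a
2b+1<2a∸1⇒b+2≤a {a} {b} 2b+1<2a∸1 = subst (_≤ a) (sym (+-suc b 1)) (*-cancelˡ-< 2 (b + 1) a 2[b+1]<2a)
  where
  1<2a : 1 < 2 * a
  1<2a = m∸n≢0⇒n<m (λ 2a∸1≡0 → n≮0 (subst (2 * b + 1 <_) 2a∸1≡0 2b+1<2a∸1))
  rearrange : ∀ b → suc (2 * b + 1) + 1 ≡ suc (2 * (b + 1))
  rearrange = solve-∀
  2[b+1]<2a : 2 * (b + 1) < 2 * a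
  2[b+1]<2a = subst (_≤ 2 * a) (rearrange b) (m≤o∸n⇒m+n≤o (suc (2 * b + 1)) (<⇒≤ 1<2a) 2b+1<2a∸1)

theorem4 : (a b : ℕ) → 0 < a → 0 < b → a + 2 < 2 * b + 1 → 2 * b + 1 < 2 * a ∸ 1 →
    ∃ λ (C : ℕ → ℕ) → IsIncreasingEnumeration a b C × (∀ n → Δ C n ≡ δxH a b n)
-- The positivity hypotheses follow from the other two.
theorem4 a b _ _ a+2<2b+1 2b+1<2a∸1 =
  cumulative ,
  enumerates-complement (InImageS a b)
    (λ gap → FactorWeight⇒InImageS (gap⇒FactorWeight gap))
    (λ m∈S → FactorWeight⇒gap (InImageS⇒FactorWeight m∈S)) ,
  Δ-cumulative
  where open Enumeration a b (2b+1<2a∸1⇒b+2≤a {a} 2b+1<2a∸1) (a+2<2b+1⇒a+2≤2b {a} {b} a+2<2b+1)
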